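{- For every integer $k$ there exists a digraph $G$ with $kpw(G)\ge k$ and $kw(G)=2$.
   Context: All digraphs are finite and simple. For $W,X\subseteq V(G)$, $X$ guards $W$ if $W\cap X=\emptyset$ and for every arc $(u,v)$ with $u\in W$ we have $v\in W\cup X$. For a DAG $T$, $i\preceq j$ means $i=j$ or there is a directed walk from $i$ to $j$; roots are nodes with no incoming arcs; children of $i$ are its out-neighbours; $W_{\succeq i}=\bigcup_{j\succeq i}W_j$. A Kelly-decomposition of $G$ is a triple $(T,(W_i)_{i\in V(T)},(X_i)_{i\in V(T)})$ with $T$ a DAG and $W_i,X_i\subseteq V(G)$ such that: (1) the $W_i$ form a partition of $V(G)$; (2) each $X_i$ guards $W_{\succeq i}$; (3) for every node $i$, its children can be enumerated $j_1,\dots,j_s$ with $X_{j_q}\subseteq W_i\cup X_i\cup\bigcup_{p<q}W_{\succeq j_p}$, and the roots can be enumerated $r_1,r_2,\dots$ with $X_{r_q}\subseteq\bigcup_{p<q}W_{\succeq r_p}$. Width is $\max_i|W_i\cup X_i|$; the Kelly-width $kw(G)$ is the minimum width. A Kelly path decomposition is a triple with $T$ a directed path graph on nodes $1,\dots,l$ (arcs $(i,i+1)$) satisfying (1), (2) and: $X_{i+1}\subseteq W_i\cup X_i$ for $1\le i<l$; the Kelly pathwidth $kpw(G)$ is its minimum width $\max_i|W_i\cup X_i|$. -}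

module Defs where

open import Data.Nat using (ℕ; suc; _≤_)
open import Data.Fin using (Fin; toℕ)
open import Data.Fin.Subset using (Subset; _∈_; _∪_; ∣_∣)
open import Data.Bool using (Bool; true; false)
open import Data.List using (List; []; _∷_)
open import Data.List.Relation.Unary.Unique.Propositional using (Unique)
open import Data.List.Membership.Propositional using () renaming (_∈_ to _∈ˡ_)
open import Data.Product using (Σ; ∃; _×_)
open import Data.Sum using (_⊎_)
open import Data.Empty using (⊥)
open import Data.Unit using (⊤)
open import Relation.Nullary using (¬_)
open import Relation.Binary.PropositionalEquality using (_≡_)
open import Function.Bundles using (_⇔_)

record Digraph : Set where
  field
    n        : ℕ
    arc      : Fin n → Fin n → Bool
    loopless : ∀ v → arc v v ≡ false

open Digraph public

-- Vertex sets given as predicates (used for derived sets like W_{⪰i}).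
VPred : ℕ → Set₁
VPred n = Fin n → Set

Guards : (G : Digraph) → VPred (n G) → VPred (n G) → Set
Guards G W X =
  (∀ v → W v → X v → ⊥) ×
  (∀ u v → W u → arc G u v ≡ true → W v ⊎ X v)

-- W_i (i ranging over Fin m) form a partition of V(G)
-- (parts may be empty).
Partition : (G : Digraph) {m : ℕ} → (Fin m → Subset (n G)) → Set
Partition G W =
  (∀ v → ∃ λ i → v ∈ W i) ×
  (∀ v i j → v ∈ W i → v ∈ W j → i ≡ j)

data Reach {m : ℕ} (A : Fin m → Fin m → Bool) : Fin m → Fin m → Set where
  here : ∀ {i} → Reach A i i
  step : ∀ {i j k} → A i j ≡ true → Reach A j k → Reach A i k

record DAG : Set where
  field
    m       : ℕ
    tarc    : Fin m → Fin m → Bool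
    acyclic : ∀ i j → tarc i j ≡ true → ¬ Reach tarc j i

open DAG public

IsRoot : (T : DAG) → Fin (m T) → Set
IsRoot T j = ∀ i → tarc T i j ≡ false

module KellyConditions (G : Digraph) (T : DAG)
                       (W X : Fin (m T) → Subset (n G)) where

  W≥ : Fin (m T) → VPred (n G)
  W≥ i v = ∃ λ j → Reach (tarc T) i j × v ∈ W j

  -- An enumeration j_1, ..., j_s is admissible relative to a base set B
  -- if X_{j_q} ⊆ B ∪ ⋃_{p<q} W_{⪰ j_p} for all q.
  Admissible : VPred (n G) → List (Fin (m T)) → Set
  Admissible B []       = ⊤
  Admissible B (j ∷ js) =
    (∀ v → v ∈ X j → B v) × Admissible (λ v → B v ⊎ W≥ j v) js

  ChildrenCond : Fin (m T) → Set
  ChildrenCond i = ∃ λ (cs : List (Fin (m T))) →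
    Unique cs × (∀ j → (j ∈ˡ cs) ⇔ (tarc T i j ≡ true)) ×
    Admissible (λ v → v ∈ W i ⊎ v ∈ X i) cs

  RootsCond : Set
  RootsCond = ∃ λ (rs : List (Fin (m T))) →
    Unique rs × (∀ j → (j ∈ˡ rs) ⇔ IsRoot T j) ×
    Admissible (λ _ → ⊥) rs

record KellyDecomposition (G : Digraph) : Set₁ where
  field
    T : DAG
    W : Fin (m T) → Subset (n G)
    X : Fin (m T) → Subset (n G)
  open KellyConditions G T W X
  field
    partition : Partition G W
    guarding  : ∀ i → Guards G (W≥ i) (λ v → v ∈ X i)
    children  : ∀ i → ChildrenCond i
    roots     : RootsCond

HasKellyDecompositionOfWidth≤ : Digraph → ℕ → Set₁
HasKellyDecompositionOfWidth≤ G w = Σ (KellyDecomposition G) λ D →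
  ∀ i → ∣ KellyDecomposition.W D i ∪ KellyDecomposition.X D i ∣ ≤ w

KellyWidth : Digraph → ℕ → Set₁
KellyWidth G k =
  HasKellyDecompositionOfWidth≤ G k ×
  (∀ w → HasKellyDecompositionOfWidth≤ G w → k ≤ w)

-- Kelly path decompositions: T is the directed path 1 → 2 → … → l,
-- here with nodes Fin l and arcs (i, i+1); so j ⪰ i iff toℕ i ≤ toℕ j.

record KellyPathDecomposition (G : Digraph) : Set where
  field
    l : ℕ
    W : Fin l → Subset (n G)
    X : Fin l → Subset (n G)
    partition : Partition G W
    guarding  : ∀ i → Guards G (λ v → ∃ λ j → toℕ i ≤ toℕ j × v ∈ W j)
                               (λ v → v ∈ X i)
    pathCond  : ∀ i j → toℕ j ≡ suc (toℕ i) →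
                ∀ v → v ∈ X j → v ∈ W i ⊎ v ∈ X i

HasKellyPathDecompositionOfWidth≤ : Digraph → ℕ → Set
HasKellyPathDecompositionOfWidth≤ G w = Σ (KellyPathDecomposition G) λ D →
  ∀ i → ∣ KellyPathDecomposition.W D i ∪ KellyPathDecomposition.X D i ∣ ≤ w

KellyPathwidth : Digraph → ℕ → Set
KellyPathwidth G k =
  HasKellyPathDecompositionOfWidth≤ G k ×
  (∀ w → HasKellyPathDecompositionOfWidth≤ G w → k ≤ w)

-- The witness is the complete ternary tree of height h = k + 1 with every
-- edge replaced by a 2-cycle.  Its Kelly-width is 2: the tree oriented away
-- from the root, with singleton bags each guarded by the parent, is a
-- Kelly-decomposition, and a 2-cycle already forces width 2.  Its Kelly
-- pathwidth is h + 1.  For the upper bound take singleton bags in preorder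
-- and guard bag i by the vertices before i with a child at or after i; these
-- are ancestors of i.  For the lower bound show by induction on h that for
-- every subtree of height h some bag t has h + 1 of its vertices in W t ∪ X t,
-- while the subtree has vertices placed at or before t and at or after t.
-- Order the three child subtrees by their bags t and use the median one: the
-- walk through the root from an early vertex of the first to a late vertex of
-- the last adds a vertex of W t ∪ X t outside the median subtree.

module Submission where

open import Data.Bool using (Bool; true; false; _∨_)
open import Data.Bool.Properties using (∨-zeroʳ)
open import Data.Empty using (⊥; ⊥-elim)
open import Data.Fin using (Fin; zero; suc; toℕ; fromℕ<)
open import Data.Fin.Properties using (toℕ-injective; toℕ<n; toℕ-fromℕ<; any?) renaming (suc-injective to fsuc-injective)
open import Data.Fin.Subset using (Subset; _∈_; _∪_; ∣_∣; ⁅_⁆)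
open import Data.Fin.Subset.Properties using (x∈p∪q⁺; x∈p∪q⁻; x∈⁅x⁆; x∈⁅y⁆⇒x≡y)
open import Data.List using (List; []; _∷_; length; map; _++_; filter; allFin)
open import Data.List.Membership.Propositional using () renaming (_∈_ to _∈ˡ_)
open import Data.List.Membership.Propositional.Properties using (∈-∃++; ∈-++⁻; ∈-++⁺ˡ; ∈-++⁺ʳ; ∈-map⁺; ∈-map⁻; ∈-filter⁺; ∈-filter⁻; ∈-allFin)
open import Data.List.Properties using (length-map; length-++)
open import Data.List.Relation.Unary.All as All using (All; []; _∷_)
open import Data.List.Relation.Unary.AllPairs using ([]; _∷_)
open import Data.List.Relation.Unary.Any using (here; there)
open import Data.List.Relation.Unary.Unique.Propositional using (Unique)
import Data.List.Relation.Unary.Unique.Propositional.Properties as Unique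
open import Data.Nat using (ℕ; zero; suc; _+_; _≤_; _<_; z≤n; s≤s; z<s)
open import Data.Nat.Induction using (<-wellFounded)
open import Data.Nat.Properties
open import Data.Product using (Σ; ∃; _×_; _,_; proj₁; proj₂)
open import Data.Sum using (_⊎_; inj₁; inj₂; swap)
open import Data.Unit using (tt)
open import Data.Vec using ([]; _∷_; tabulate; here; there)
open import Data.Vec.Properties using (lookup∘tabulate; []=⇒lookup; lookup⇒[]=)
open import Function using (_∘_)
open import Function.Bundles using (mk⇔)
open import Induction.WellFounded using (Acc; acc)
open import Relation.Binary.Construct.Closure.ReflexiveTransitive using (Star; ε; _◅_; _◅◅_; reverse) renaming (map to mapStar)
open import Relation.Binary.PropositionalEquality
open import Relation.Nullary using (¬_; Dec; does; yes; no; contradiction)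
open import Relation.Nullary.Decidable using (dec-true; dec-false; _×-dec_)
open import Relation.Unary using (Decidable)

open import Defs

Unique⇒length≤ : {A : Set} {xs ys : List A} → Unique xs →
                 (∀ {z} → z ∈ˡ xs → z ∈ˡ ys) → length xs ≤ length ys
Unique⇒length≤ {xs = []} _ _ = z≤n
Unique⇒length≤ {xs = x ∷ xs} {ys} (x∉xs ∷ xs!) xs⊆ys with ∈-∃++ (xs⊆ys (here refl))
... | ys₁ , ys₂ , refl = begin
  suc (length xs)              ≤⟨ s≤s (Unique⇒length≤ xs! xs⊆ys₁++ys₂) ⟩
  suc (length (ys₁ ++ ys₂))    ≡⟨ cong suc (length-++ ys₁) ⟩
  suc (length ys₁ + length ys₂) ≡⟨ +-suc (length ys₁) (length ys₂) ⟨
  length ys₁ + length (x ∷ ys₂) ≡⟨ length-++ ys₁ ⟨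
  length (ys₁ ++ x ∷ ys₂)      ∎
  where
  open ≤-Reasoning
  xs⊆ys₁++ys₂ : ∀ {z} → z ∈ˡ xs → z ∈ˡ ys₁ ++ ys₂
  xs⊆ys₁++ys₂ z∈xs with ∈-++⁻ ys₁ (xs⊆ys (there z∈xs))
  ... | inj₁ z∈ys₁        = ∈-++⁺ˡ z∈ys₁
  ... | inj₂ (here refl) = ⊥-elim (All.lookup x∉xs z∈xs refl)
  ... | inj₂ (there z∈ys₂) = ∈-++⁺ʳ ys₁ z∈ys₂

elements : ∀ {n} → Subset n → List (Fin n)
elements []            = []
elements (true  ∷ p) = zero ∷ map suc (elements p)
elements (false ∷ p) = map suc (elements p)

length-elements : ∀ {n} (p : Subset n) → length (elements p) ≡ ∣ p ∣
length-elements []          = refl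
length-elements (true ∷ p)  = cong suc (trans (length-map suc (elements p)) (length-elements p))
length-elements (false ∷ p) = trans (length-map suc (elements p)) (length-elements p)

∈-elements⁻ : ∀ {n} (p : Subset n) {x} → x ∈ˡ elements p → x ∈ p
∈-elements⁻ (true ∷ p) (here refl) = here
∈-elements⁻ (true ∷ p) (there x∈) with ∈-map⁻ suc x∈
... | y , y∈ , refl = there (∈-elements⁻ p y∈)
∈-elements⁻ (false ∷ p) x∈ with ∈-map⁻ suc x∈
... | y , y∈ , refl = there (∈-elements⁻ p y∈)

∈-elements⁺ : ∀ {n} (p : Subset n) {x} → x ∈ p → x ∈ˡ elements p
∈-elements⁺ (true ∷ p)  here       = here refl
∈-elements⁺ (true ∷ p)  (there x∈) = there (∈-map⁺ suc (∈-elements⁺ p x∈))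
∈-elements⁺ (false ∷ p) (there x∈) = ∈-map⁺ suc (∈-elements⁺ p x∈)

Unique-elements : ∀ {n} (p : Subset n) → Unique (elements p)
Unique-elements []          = []
Unique-elements (true ∷ p)  = All.tabulate zero∉ ∷ Unique.map⁺ fsuc-injective (Unique-elements p)
  where
  zero∉ : ∀ {y} → y ∈ˡ map suc (elements p) → zero ≢ y
  zero∉ y∈ refl with ∈-map⁻ suc y∈
  ... | _ , _ , ()
Unique-elements (false ∷ p) = Unique.map⁺ fsuc-injective (Unique-elements p)

Unique⇒length≤∣p∣ : ∀ {n} (p : Subset n) {xs : List (Fin n)} → Unique xs →
                   All (_∈ p) xs → length xs ≤ ∣ p ∣
Unique⇒length≤∣p∣ p {xs} xs! xs⊆p = begin
  length xs ≤⟨ Unique⇒length≤ xs! (λ z∈ → ∈-elements⁺ p (All.lookup xs⊆p z∈)) ⟩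
  length (elements p) ≡⟨ length-elements p ⟩
  ∣ p ∣ ∎
  where open ≤-Reasoning

∣p∣≤length : ∀ {n} (p : Subset n) (ns : List ℕ) → (∀ x → x ∈ p → toℕ x ∈ˡ ns) → ∣ p ∣ ≤ length ns
∣p∣≤length p ns p⊆ns = begin
  ∣ p ∣                          ≡⟨ length-elements p ⟨
  length (elements p)            ≡⟨ length-map toℕ (elements p) ⟨
  length (map toℕ (elements p)) ≤⟨ Unique⇒length≤ (Unique.map⁺ toℕ-injective (Unique-elements p)) ⊆ns ⟩
  length ns                      ∎
  where
  open ≤-Reasoning
  ⊆ns : ∀ {z} → z ∈ˡ map toℕ (elements p) → z ∈ˡ ns
  ⊆ns z∈ with ∈-map⁻ toℕ z∈
  ... | x , x∈ , refl = p⊆ns x (∈-elements⁻ p x∈)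

decSubset : ∀ {n} {P : Fin n → Set} → Decidable P → Subset n
decSubset P? = tabulate (λ x → does (P? x))

∈-decSubset⁺ : ∀ {n} {P : Fin n → Set} (P? : Decidable P) {x} → P x → x ∈ decSubset P?
∈-decSubset⁺ P? {x} px = lookup⇒[]= x _ (trans (lookup∘tabulate _ x) (dec-true (P? x) px))

∈-decSubset⁻ : ∀ {n} {P : Fin n → Set} (P? : Decidable P) {x} → x ∈ decSubset P? → P x
∈-decSubset⁻ P? {x} x∈ with P? x | trans (sym (lookup∘tabulate (λ y → does (P? y)) x)) ([]=⇒lookup x∈)
... | yes px | _ = px

does≡true⇒ : {P : Set} (P? : Dec P) → does P? ≡ true → P
does≡true⇒ (yes p) _ = p

2≤∣p∣ : ∀ {n} {p : Subset n} {x y} → x ≢ y → x ∈ p → y ∈ p → 2 ≤ ∣ p ∣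
2≤∣p∣ {p = p} x≢y x∈p y∈p = Unique⇒length≤∣p∣ p ((x≢y ∷ []) ∷ [] ∷ []) (x∈p ∷ y∈p ∷ [])

module _ {m : ℕ} {A : Fin m → Fin m → Bool} where

  Reach-trans : ∀ {i j k} → Reach A i j → Reach A j k → Reach A i k
  Reach-trans here       r = r
  Reach-trans (step a q) r = step a (Reach-trans q r)

  Reach-snoc : ∀ {i j k} → Reach A i j → A j k ≡ true → Reach A i k
  Reach-snoc r a = Reach-trans r (step a here)

  Reach-unsnoc : ∀ {i k} → Reach A i k → i ≡ k ⊎ ∃ λ j → Reach A i j × A j k ≡ true
  Reach-unsnoc here = inj₁ refl
  Reach-unsnoc {i} (step a r) with Reach-unsnoc r
  ... | inj₁ refl          = inj₂ (i , here , a)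
  ... | inj₂ (j , r′ , a′) = inj₂ (j , step a r′ , a′)

Reach-antisym : (T : DAG) → ∀ {i j} → Reach (tarc T) i j → Reach (tarc T) j i → i ≡ j
Reach-antisym T here       _ = refl
Reach-antisym T (step a r) q = ⊥-elim (acyclic T _ _ a (Reach-trans r q))

singletons-Partition : (G : Digraph) → Partition G ⁅_⁆
singletons-Partition G =
  (λ v → v , x∈⁅x⁆ v) , λ v i j v∈i v∈j → trans (sym (x∈⁅y⁆⇒x≡y i v∈i)) (x∈⁅y⁆⇒x≡y j v∈j)

module _ (G : Digraph) (T : DAG) (W X : Fin (m T) → Subset (n G)) where
  open KellyConditions G T W X

  Admissible-of-⊆ : ∀ (B : Fin (n G) → Set) js →
                    (∀ {j} → j ∈ˡ js → ∀ v → v ∈ X j → B v) → Admissible B js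
  Admissible-of-⊆ B []       _      = tt
  Admissible-of-⊆ B (j ∷ js) X⊆B =
    X⊆B (here refl) , Admissible-of-⊆ _ js (λ j∈ v v∈ → inj₁ (X⊆B (there j∈) v v∈))

-- Unless u and v share a bag, one of them is in the guard of the other's bag.
module _ {G : Digraph} (D : KellyDecomposition G) where
  open KellyDecomposition D

  width≥2-of-2-cycle : {u v : Fin (n G)} {w : ℕ} → u ≢ v → arc G u v ≡ true → arc G v u ≡ true →
                       (∀ i → ∣ W i ∪ X i ∣ ≤ w) → 2 ≤ w
  width≥2-of-2-cycle {u} {v} u≢v uv vu width≤ with proj₁ partition u
  ... | i , u∈Wᵢ with proj₂ (guarding i) u v (i , here , u∈Wᵢ) uv
  ...   | inj₂ v∈Xᵢ = ≤-trans (2≤∣p∣ u≢v (x∈p∪q⁺ (inj₁ u∈Wᵢ)) (x∈p∪q⁺ (inj₂ v∈Xᵢ))) (width≤ i)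
  ...   | inj₁ (j , i⪯j , v∈Wⱼ) with proj₂ (guarding j) v u (j , here , v∈Wⱼ) vu
  ...     | inj₂ u∈Xⱼ = ≤-trans (2≤∣p∣ (u≢v ∘ sym) (x∈p∪q⁺ (inj₁ v∈Wⱼ)) (x∈p∪q⁺ (inj₂ u∈Xⱼ))) (width≤ j)
  ...     | inj₁ (i′ , j⪯i′ , u∈Wᵢ′) with proj₂ partition u i′ i u∈Wᵢ′ u∈Wᵢ
  ...       | refl with Reach-antisym T i⪯j j⪯i′
  ...         | refl = ≤-trans (2≤∣p∣ u≢v (x∈p∪q⁺ (inj₁ u∈Wᵢ)) (x∈p∪q⁺ (inj₁ v∈Wⱼ))) (width≤ i)

BackArc : (G : Digraph) → (Fin (n G) → Set) → Fin (n G) → Fin (n G) → Set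
BackArc G U x y = U y × arc G y x ≡ true

module KellyPathDecompositionProperties {G : Digraph} (D : KellyPathDecomposition G) where
  open KellyPathDecomposition D

  bag : Fin (n G) → Fin l
  bag v = proj₁ (proj₁ partition v)

  ∈-bag : ∀ v → v ∈ W (bag v)
  ∈-bag v = proj₂ (proj₁ partition v)

  bag-unique : ∀ {v t} → v ∈ W t → t ≡ bag v
  bag-unique {v} {t} v∈Wₜ = proj₂ partition v t (bag v) v∈Wₜ (∈-bag v)

  ∈W-of-bag≡ : ∀ {x t} → toℕ (bag x) ≡ toℕ t → x ∈ W t
  ∈W-of-bag≡ {x} bagx≡t = subst (λ s → x ∈ W s) (toℕ-injective bagx≡t) (∈-bag x)

  ∈W∪X-of-arc : ∀ {x y t} → toℕ (bag x) ≤ toℕ t → toℕ t ≤ toℕ (bag y) →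
                arc G y x ≡ true → x ∈ W t ∪ X t
  ∈W∪X-of-arc {x} {y} {t} bagx≤t t≤bagy yx with toℕ (bag x) ≟ toℕ t
  ... | yes bagx≡t = x∈p∪q⁺ (inj₁ (∈W-of-bag≡ bagx≡t))
  ... | no  bagx≢t with proj₂ (guarding t) y x (bag y , t≤bagy , ∈-bag y) yx
  ...   | inj₂ x∈Xₜ = x∈p∪q⁺ (inj₂ x∈Xₜ)
  ...   | inj₁ (s , t≤s , x∈Wₛ) =
          ⊥-elim (bagx≢t (≤-antisym bagx≤t (subst (λ r → toℕ t ≤ toℕ r) (bag-unique x∈Wₛ) t≤s)))

  -- The witness is the vertex just before the walk first reaches a bag at or
  -- after t.
  walk-meets-W∪X : ∀ {U : Fin (n G) → Set} {x z t} → U x → Star (BackArc G U) x z →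
                   toℕ (bag x) ≤ toℕ t → toℕ t ≤ toℕ (bag z) → ∃ λ w → U w × w ∈ W t ∪ X t
  walk-meets-W∪X {x = x} ux ε bagx≤t t≤bagx =
    x , ux , x∈p∪q⁺ (inj₁ (∈W-of-bag≡ (≤-antisym bagx≤t t≤bagx)))
  walk-meets-W∪X {x = x} {t = t} ux ((uy , yx) ◅ walk) bagx≤t t≤bagz with toℕ t ≤? toℕ (bag _)
  ... | yes t≤bagy = x , ux , ∈W∪X-of-arc bagx≤t t≤bagy yx
  ... | no  t≰bagy = walk-meets-W∪X uy walk (<⇒≤ (≰⇒> t≰bagy)) t≤bagz

-- Complete ternary trees numbered in preorder

-- The subtree of height h whose root has preorder number a occupies the
-- numbers a, …, a + size h - 1; its children are rooted at childRoot h a k.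
size : ℕ → ℕ
size zero    = 1
size (suc h) = suc (size h + size h + size h)

0<size : ∀ h → 0 < size h
0<size zero    = z<s
0<size (suc h) = z<s

data Branch : Set where
  left middle right : Branch

childRoot : ℕ → ℕ → Branch → ℕ
childRoot h a left   = suc a
childRoot h a middle = suc a + size h
childRoot h a right  = suc a + size h + size h

InSubtree : ℕ → ℕ → ℕ → Set
InSubtree h a v = a ≤ v × v < a + size h

root∈Subtree : ∀ h a → InSubtree h a a
root∈Subtree h a = ≤-refl , m<m+n a (0<size h)

InSubtree-zero : ∀ {a v} → InSubtree 0 a v → v ≡ a
InSubtree-zero {a} {v} (a≤v , v<a+1) = ≤-antisym (≤-pred (subst (v <_) (+-comm a 1) v<a+1)) a≤v

a+size-suc : ∀ h a → a + size (suc h) ≡ childRoot h a right + size h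
a+size-suc h a = begin
  a + suc (size h + size h + size h)   ≡⟨ +-suc a _ ⟩
  suc (a + (size h + size h + size h)) ≡⟨ cong suc (+-assoc a (size h + size h) (size h)) ⟨
  suc (a + (size h + size h) + size h) ≡⟨ cong (λ m → suc (m + size h)) (+-assoc a (size h) (size h)) ⟨
  suc a + size h + size h + size h     ∎
  where open ≡-Reasoning

root<childRoot : ∀ h a k → a < childRoot h a k
root<childRoot h a left   = ≤-refl
root<childRoot h a middle = m≤m+n (suc a) (size h)
root<childRoot h a right  = ≤-trans (m≤m+n (suc a) (size h)) (m≤m+n (suc a + size h) (size h))

childRoot+size≤ : ∀ h a k → childRoot h a k + size h ≤ a + size (suc h)
childRoot+size≤ h a k = subst (childRoot h a k + size h ≤_) (sym (a+size-suc h a)) (≤right k)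
  where
  ≤right : ∀ k → childRoot h a k + size h ≤ childRoot h a right + size h
  ≤right left   = ≤-trans (m≤m+n _ (size h)) (m≤m+n _ (size h))
  ≤right middle = m≤m+n _ (size h)
  ≤right right  = ≤-refl

root<InChild : ∀ h a k {v} → InSubtree h (childRoot h a k) v → a < v
root<InChild h a k (c≤v , _) = <-≤-trans (root<childRoot h a k) c≤v

InChild⇒InSubtree : ∀ h a k {v} → InSubtree h (childRoot h a k) v → InSubtree (suc h) a v
InChild⇒InSubtree h a k v∈@(_ , v<c+size) =
  <⇒≤ (root<InChild h a k v∈) , <-≤-trans v<c+size (childRoot+size≤ h a k)

-- Meaningful only for a < v < a + size (suc h).
branch : ℕ → ℕ → ℕ → Branch
branch h a v with v <? childRoot h a middle | v <? childRoot h a right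
... | yes _ | _     = left
... | no  _ | yes _ = middle
... | no  _ | no  _ = right

branch-spec : ∀ h a k {v} → InSubtree h (childRoot h a k) v → branch h a v ≡ k
branch-spec h a k {v} (c≤v , v<c+size) with v <? childRoot h a middle | v <? childRoot h a right | k
... | yes _ | _     | left   = refl
... | yes p | _     | middle = contradiction c≤v (<⇒≱ p)
... | yes p | _     | right  = contradiction c≤v (<⇒≱ (<-≤-trans p (m≤m+n _ (size h))))
... | no ¬p | _     | left   = contradiction v<c+size ¬p
... | no _  | yes _ | middle = refl
... | no _  | yes p | right  = contradiction c≤v (<⇒≱ p)
... | no _  | no ¬p | middle = contradiction v<c+size ¬p
... | no _  | no _  | right  = refl

InSubtree-branch : ∀ h a {v} → a < v → v < a + size (suc h) → InSubtree h (childRoot h a (branch h a v)) v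
InSubtree-branch h a {v} a<v v<a+size with v <? childRoot h a middle | v <? childRoot h a right
... | yes p | _     = a<v , p
... | no ¬p | yes q = ≮⇒≥ ¬p , q
... | no _  | no ¬q = ≮⇒≥ ¬q , subst (v <_) (a+size-suc h a) v<a+size

-- Meaningful only for a < v < a + size h.
parent : ℕ → ℕ → ℕ → ℕ
parent zero    a v = a
parent (suc h) a v with v ≟ childRoot h a (branch h a v)
... | yes _ = a
... | no  _ = parent h (childRoot h a (branch h a v)) v

parent-childRoot : ∀ h a k → parent (suc h) a (childRoot h a k) ≡ a
parent-childRoot h a k with childRoot h a k ≟ childRoot h a (branch h a (childRoot h a k))
... | yes _ = refl
... | no c≢ = contradiction (cong (childRoot h a) (sym (branch-spec h a k (root∈Subtree h _)))) c≢

parent-inChild : ∀ h a k {v} → InSubtree h (childRoot h a k) v → v ≢ childRoot h a k →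
                 parent (suc h) a v ≡ parent h (childRoot h a k) v
parent-inChild h a k {v} v∈ v≢c with v ≟ childRoot h a (branch h a v)
... | yes v≡c = contradiction (trans v≡c (cong (childRoot h a) (branch-spec h a k v∈))) v≢c
... | no  _   = cong (λ k → parent h (childRoot h a k) v) (branch-spec h a k v∈)

parent-range : ∀ h a {v} → a < v → v < a + size h → a ≤ parent h a v × parent h a v < v
parent-range zero    a {v} a<v v<a+1 = contradiction (InSubtree-zero (<⇒≤ a<v , v<a+1)) (>⇒≢ a<v)
parent-range (suc h) a {v} a<v v<a+size with v ≟ childRoot h a (branch h a v)
... | yes _   = ≤-refl , a<v
... | no  v≢c = ≤-trans (<⇒≤ (root<childRoot h a (branch h a v))) (proj₁ below-child) , proj₂ below-child
  where
  v∈ = InSubtree-branch h a a<v v<a+size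
  below-child = parent-range h _ (≤∧≢⇒< (proj₁ v∈) (v≢c ∘ sym)) (proj₂ v∈)

ancestors : ℕ → ℕ → ℕ → List ℕ
ancestors zero    a i = []
ancestors (suc h) a i with i ≟ a
... | yes _ = []
... | no  _ = a ∷ ancestors h (childRoot h a (branch h a i)) i

length-ancestors : ∀ h a i → length (ancestors h a i) ≤ h
length-ancestors zero    a i = z≤n
length-ancestors (suc h) a i with i ≟ a
... | yes _ = z≤n
... | no  _ = s≤s (length-ancestors h _ i)

-- Subtrees are intervals, so a parent u < i of some v ≥ i is an ancestor of i.
∈-ancestors : ∀ h a {u i v} → a ≤ u → u < i → i ≤ v → v < a + size h →
              parent h a v ≡ u → u ∈ˡ ancestors h a i
∈-ancestors zero    a {u} {i} {v} a≤u u<i i≤v v<a+1 _ =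
  contradiction (InSubtree-zero (≤-trans a≤u (≤-trans (<⇒≤ u<i) i≤v) , v<a+1))
                (>⇒≢ (<-≤-trans (≤-<-trans a≤u u<i) i≤v))
∈-ancestors (suc h) a {u} {i} {v} a≤u u<i i≤v v<a+size pv≡u with i ≟ a
... | yes refl = contradiction (≤-<-trans a≤u u<i) (<-irrefl refl)
... | no  _ with u ≟ a
...   | yes u≡a = here u≡a
...   | no  u≢a = there (subst (λ k → u ∈ˡ ancestors h (childRoot h a k) i) (sym i∈k)
                    (∈-ancestors h c c≤u u<i i≤v (proj₂ v∈) pcv≡u))
  where
  k = branch h a v
  c = childRoot h a k
  v∈ = InSubtree-branch h a (<-≤-trans (≤-<-trans a≤u u<i) i≤v) v<a+size
  v≢c : v ≢ c
  v≢c v≡c = u≢a (trans (sym pv≡u) (trans (cong (parent (suc h) a) v≡c) (parent-childRoot h a k)))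
  pcv≡u : parent h c v ≡ u
  pcv≡u = trans (sym (parent-inChild h a k v∈ v≢c)) pv≡u
  c≤u : c ≤ u
  c≤u = subst (c ≤_) pcv≡u (proj₁ (parent-range h c (≤∧≢⇒< (proj₁ v∈) (v≢c ∘ sym)) (proj₂ v∈)))
  i∈k : branch h a i ≡ k
  i∈k = branch-spec h a k (≤-trans c≤u (<⇒≤ u<i) , ≤-<-trans i≤v (proj₂ v∈))

InChild-disjoint : ∀ h a {k k′ v} → k ≢ k′ → InSubtree h (childRoot h a k) v →
                   ¬ InSubtree h (childRoot h a k′) v
InChild-disjoint h a {k} {k′} k≢k′ v∈k v∈k′ =
  k≢k′ (trans (sym (branch-spec h a k v∈k)) (branch-spec h a k′ v∈k′))

median-branch : (f : Branch → ℕ) → ∃ λ A → ∃ λ B → ∃ λ C → A ≢ B × C ≢ B × f A ≤ f B × f B ≤ f C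
median-branch f with ≤-total (f left) (f middle) | ≤-total (f middle) (f right) | ≤-total (f left) (f right)
... | inj₁ l≤m | inj₁ m≤r | _        = left   , middle , right  , (λ ()) , (λ ()) , l≤m , m≤r
... | inj₁ l≤m | inj₂ r≤m | inj₁ l≤r = left   , right  , middle , (λ ()) , (λ ()) , l≤r , r≤m
... | inj₁ l≤m | inj₂ _   | inj₂ r≤l = right  , left   , middle , (λ ()) , (λ ()) , r≤l , l≤m
... | inj₂ m≤l | _        | inj₁ l≤r = middle , left   , right  , (λ ()) , (λ ()) , m≤l , l≤r
... | inj₂ _   | inj₁ m≤r | inj₂ r≤l = middle , right  , left   , (λ ()) , (λ ()) , m≤r , r≤l
... | inj₂ m≤l | inj₂ r≤m | inj₂ _   = right  , middle , left   , (λ ()) , (λ ()) , r≤m , m≤l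

-- The bidirected complete ternary tree

module TernaryTree (H : ℕ) where

  Vertex : Set
  Vertex = Fin (size H)

  _IsParentOf_ : Vertex → Vertex → Set
  u IsParentOf v = 0 < toℕ v × parent H 0 (toℕ v) ≡ toℕ u

  _isParentOf?_ : ∀ u v → Dec (u IsParentOf v)
  u isParentOf? v = (0 <? toℕ v) ×-dec (parent H 0 (toℕ v) ≟ toℕ u)

  IsParentOf⇒< : ∀ {u v} → u IsParentOf v → toℕ u < toℕ v
  IsParentOf⇒< {u} {v} (0<v , pv≡u) = subst (_< toℕ v) pv≡u (proj₂ (parent-range H 0 0<v (toℕ<n v)))

  IsParentOf-unique : ∀ {u u′ v} → u IsParentOf v → u′ IsParentOf v → u ≡ u′
  IsParentOf-unique (_ , pv≡u) (_ , pv≡u′) = toℕ-injective (trans (sym pv≡u) pv≡u′)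

  treeArc : Vertex → Vertex → Bool
  treeArc u v = does (u isParentOf? v)

  Reach⇒≤ : ∀ {u v} → Reach treeArc u v → toℕ u ≤ toℕ v
  Reach⇒≤ here       = ≤-refl
  Reach⇒≤ (step a r) = ≤-trans (<⇒≤ (IsParentOf⇒< (does≡true⇒ (_ isParentOf? _) a))) (Reach⇒≤ r)

  tree : DAG
  tree = record
    { m       = size H
    ; tarc    = treeArc
    ; acyclic = λ u v a r → <⇒≱ (IsParentOf⇒< (does≡true⇒ (u isParentOf? v) a)) (Reach⇒≤ r)
    }

  Edge : Vertex → Vertex → Set
  Edge u v = u IsParentOf v ⊎ v IsParentOf u

  bidirectedTree : Digraph
  bidirectedTree = record
    { n        = size H
    ; arc      = λ u v → treeArc u v ∨ treeArc v u
    ; loopless = λ v → cong (λ b → b ∨ b) (dec-false (v isParentOf? v) (λ p → <-irrefl refl (IsParentOf⇒< p)))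
    }

  arc-of-Edge : ∀ {u v} → Edge u v → arc bidirectedTree u v ≡ true
  arc-of-Edge {u} {v} (inj₁ p) = cong (_∨ treeArc v u) (dec-true (u isParentOf? v) p)
  arc-of-Edge {u} {v} (inj₂ p) = trans (cong (treeArc u v ∨_) (dec-true (v isParentOf? u) p)) (∨-zeroʳ _)

  Edge-of-arc : ∀ {u v} → arc bidirectedTree u v ≡ true → Edge u v
  Edge-of-arc {u} {v} uv with treeArc u v in u→v
  ... | true  = inj₁ (does≡true⇒ (u isParentOf? v) u→v)
  ... | false = inj₂ (does≡true⇒ (v isParentOf? u) uv)

  -- Position h a: the tree has a subtree of height h rooted at number a.
  data Position : ℕ → ℕ → Set where
    whole : Position H 0
    child : ∀ {h a} k → Position (suc h) a → Position h (childRoot h a k)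

  Position-bound : ∀ {h a} → Position h a → a + size h ≤ size H
  Position-bound whole       = ≤-refl
  Position-bound (child k p) = ≤-trans (childRoot+size≤ _ _ k) (Position-bound p)

  parent-Position : ∀ {h a v} → Position h a → a < v → v < a + size h → parent H 0 v ≡ parent h a v
  parent-Position whole a<v v< = refl
  parent-Position (child k p) c<v v<c+size =
    trans (parent-Position p (root<InChild _ _ k v∈) (proj₂ (InChild⇒InSubtree _ _ k v∈)))
          (parent-inChild _ _ k v∈ (>⇒≢ c<v))
    where v∈ = <⇒≤ c<v , v<c+size

  rootVertex : ∀ {h a} → Position h a → Vertex
  rootVertex {h} {a} p = fromℕ< (<-≤-trans (m<m+n a (0<size h)) (Position-bound p))

  toℕ-rootVertex : ∀ {h a} (p : Position h a) → toℕ (rootVertex p) ≡ a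
  toℕ-rootVertex p = toℕ-fromℕ< _

  InSubtreeᵛ : ℕ → ℕ → Vertex → Set
  InSubtreeᵛ h a x = InSubtree h a (toℕ x)

  rootVertex∈ : ∀ {h a} (p : Position h a) → InSubtreeᵛ h a (rootVertex p)
  rootVertex∈ {h} {a} p = subst (InSubtree h a) (sym (toℕ-rootVertex p)) (root∈Subtree h a)

  parentWithin : ∀ {h a x} → Position h a → InSubtreeᵛ h a x → toℕ x ≢ a →
                 ∃ λ q → InSubtreeᵛ h a q × q IsParentOf x
  parentWithin {h} {a} {x} p (a≤x , x<a+size) x≢a =
    q , subst (InSubtree h a) (sym toℕ-q) (a≤px , <-trans px<x x<a+size) ,
    ≤-<-trans z≤n a<x , trans (parent-Position p a<x x<a+size) (sym toℕ-q)
    where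
    a<x = ≤∧≢⇒< a≤x (x≢a ∘ sym)
    a≤px = proj₁ (parent-range h a a<x x<a+size)
    px<x = proj₂ (parent-range h a a<x x<a+size)
    q = fromℕ< (<-trans px<x (toℕ<n x))
    toℕ-q : toℕ q ≡ parent h a (toℕ x)
    toℕ-q = toℕ-fromℕ< _

  rootVertex-IsParentOf : ∀ {h a} k (p : Position (suc h) a) → rootVertex p IsParentOf rootVertex (child k p)
  rootVertex-IsParentOf {h} {a} k p =
    subst (0 <_) (sym (toℕ-rootVertex (child k p))) (≤-<-trans z≤n a<c) , (begin
    parent H 0 (toℕ (rootVertex (child k p))) ≡⟨ cong (parent H 0) (toℕ-rootVertex (child k p)) ⟩
    parent H 0 c                                ≡⟨ parent-Position p a<c c<a+size ⟩
    parent (suc h) a c                          ≡⟨ parent-childRoot h a k ⟩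
    a                                           ≡⟨ toℕ-rootVertex p ⟨
    toℕ (rootVertex p)                          ∎)
    where
    open ≡-Reasoning
    c = childRoot h a k
    a<c = root<childRoot h a k
    c<a+size = proj₂ (InChild⇒InSubtree h a k (root∈Subtree h c))

  EdgeWithin : (Vertex → Set) → Vertex → Vertex → Set
  EdgeWithin U x y = U x × U y × Edge x y

  EdgeWithin-sym : ∀ {U x y} → EdgeWithin U x y → EdgeWithin U y x
  EdgeWithin-sym (ux , uy , xy) = uy , ux , swap xy

  EdgeWithin⇒BackArc : ∀ {U x y} → EdgeWithin U x y → BackArc bidirectedTree U x y
  EdgeWithin⇒BackArc (_ , uy , xy) = uy , arc-of-Edge (swap xy)

  walk-to-root : ∀ {h a x} (p : Position h a) → InSubtreeᵛ h a x →
                 Star (EdgeWithin (InSubtreeᵛ h a)) x (rootVertex p)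
  walk-to-root {h} {a} p x∈ = go x∈ (<-wellFounded _)
    where
    go : ∀ {x} → InSubtreeᵛ h a x → Acc _<_ (toℕ x) → Star (EdgeWithin (InSubtreeᵛ h a)) x (rootVertex p)
    go {x} x∈ (acc below) with toℕ x ≟ a
    ... | yes x≡a = subst (Star _ x) (toℕ-injective (trans x≡a (sym (toℕ-rootVertex p)))) ε
    ... | no  x≢a with parentWithin p x∈ x≢a
    ...   | q , q∈ , q→x = (x∈ , q∈ , inj₂ q→x) ◅ go q∈ (below (IsParentOf⇒< q→x))

  OutsideChild : ℕ → ℕ → Branch → Vertex → Set
  OutsideChild h a B x = InSubtreeᵛ (suc h) a x × ¬ InSubtreeᵛ h (childRoot h a B) x

  OutsideChild-of-sibling : ∀ {h a k B x} → k ≢ B → InSubtreeᵛ h (childRoot h a k) x → OutsideChild h a B x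
  OutsideChild-of-sibling {h} {a} {k} k≢B x∈ = InChild⇒InSubtree h a k x∈ , InChild-disjoint h a k≢B x∈

  walk-between-siblings : ∀ {h a} (p : Position (suc h) a) {A B C} → A ≢ B → C ≢ B → ∀ {x z} →
                          InSubtreeᵛ h (childRoot h a A) x → InSubtreeᵛ h (childRoot h a C) z →
                          Star (EdgeWithin (OutsideChild h a B)) x z
  walk-between-siblings {h} {a} p {A} {B} {C} A≢B C≢B x∈A z∈C =
       mapStar (within-sibling A≢B) (walk-to-root (child A p) x∈A)
    ◅◅ (OutsideChild-of-sibling A≢B (rootVertex∈ (child A p)) , root-outside ,
        inj₂ (rootVertex-IsParentOf A p))
    ◅  (root-outside , OutsideChild-of-sibling C≢B (rootVertex∈ (child C p)) ,
        inj₁ (rootVertex-IsParentOf C p))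
    ◅  reverse EdgeWithin-sym (mapStar (within-sibling C≢B) (walk-to-root (child C p) z∈C))
    where
    root-outside : OutsideChild h a B (rootVertex p)
    root-outside = rootVertex∈ p ,
      λ r∈B → <⇒≱ (root<childRoot h a B) (subst (childRoot h a B ≤_) (toℕ-rootVertex p) (proj₁ r∈B))
    within-sibling : ∀ {k} → k ≢ B → ∀ {x y} →
                     EdgeWithin (InSubtreeᵛ h (childRoot h a k)) x y → EdgeWithin (OutsideChild h a B) x y
    within-sibling k≢B (x∈ , y∈ , xy) =
      OutsideChild-of-sibling k≢B x∈ , OutsideChild-of-sibling k≢B y∈ , xy

  parentSet : Vertex → Subset (size H)
  parentSet v = decSubset (_isParentOf? v)

  module _ where
    open KellyConditions bidirectedTree tree ⁅_⁆ parentSet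

    W≥-closed : ∀ i {u v} → W≥ i u → arc bidirectedTree u v ≡ true → W≥ i v ⊎ v ∈ parentSet i
    W≥-closed i {u} {v} (j , i⪯j , u∈j) uv with x∈⁅y⁆⇒x≡y j u∈j | Edge-of-arc uv
    ... | refl | inj₁ u→v = inj₁ (v , Reach-snoc i⪯j (dec-true (u isParentOf? v) u→v) , x∈⁅x⁆ v)
    ... | refl | inj₂ v→u with Reach-unsnoc i⪯j
    ...   | inj₁ refl = inj₂ (∈-decSubset⁺ (_isParentOf? i) v→u)
    ...   | inj₂ (w , i⪯w , w→u) with IsParentOf-unique (does≡true⇒ (w isParentOf? u) w→u) v→u
    ...     | refl = inj₁ (w , i⪯w , x∈⁅x⁆ w)

    W≥-disjoint : ∀ i v → W≥ i v → v ∈ parentSet i → ⊥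
    W≥-disjoint i v (j , i⪯j , v∈j) v∈X with x∈⁅y⁆⇒x≡y j v∈j
    ... | refl = <⇒≱ (IsParentOf⇒< (∈-decSubset⁻ (_isParentOf? i) v∈X)) (Reach⇒≤ i⪯j)

    childrenCond : ∀ i → ChildrenCond i
    childrenCond i = filter (i isParentOf?_) (allFin _) ,
      Unique.filter⁺ (i isParentOf?_) (Unique.allFin⁺ _) ,
      (λ j → mk⇔ (dec-true (i isParentOf? j) ∘ proj₂ ∘ ∈-filter⁻ (i isParentOf?_) {xs = allFin _})
                 (∈-filter⁺ (i isParentOf?_) (∈-allFin j) ∘ does≡true⇒ (i isParentOf? j))) ,
      Admissible-of-⊆ bidirectedTree tree ⁅_⁆ parentSet _ _ parent∈W
      where
      parent∈W : ∀ {j} → j ∈ˡ filter (i isParentOf?_) (allFin _) →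
                 ∀ v → v ∈ parentSet j → v ∈ ⁅ i ⁆ ⊎ v ∈ parentSet i
      parent∈W j∈ v v∈
        with IsParentOf-unique (∈-decSubset⁻ (_isParentOf? _) v∈)
                               (proj₂ (∈-filter⁻ (i isParentOf?_) {xs = allFin _} j∈))
      ... | refl = inj₁ (x∈⁅x⁆ v)

    root : Vertex
    root = rootVertex whole

    ¬IsParentOf-root : ∀ u → ¬ u IsParentOf root
    ¬IsParentOf-root u (0<r , _) = <-irrefl (sym (toℕ-rootVertex whole)) 0<r

    IsRoot⇒≡root : ∀ j → IsRoot tree j → j ≡ root
    IsRoot⇒≡root j j-root with toℕ j ≟ 0
    ... | yes j≡0 = toℕ-injective (trans j≡0 (sym (toℕ-rootVertex whole)))
    ... | no  j≢0 with parentWithin whole (z≤n , toℕ<n j) j≢0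
    ...   | q , _ , q→j = contradiction (trans (sym (dec-true (q isParentOf? j) q→j)) (j-root q)) (λ ())

    rootsCond : RootsCond
    rootsCond = root ∷ [] , [] ∷ [] ,
      (λ j → mk⇔ (λ { (here refl) i → dec-false (i isParentOf? root) (¬IsParentOf-root i) })
                 (λ j-root → here (IsRoot⇒≡root j j-root))) ,
      (λ v v∈ → ¬IsParentOf-root v (∈-decSubset⁻ (_isParentOf? root) v∈)) , tt

  kellyDecomposition : KellyDecomposition bidirectedTree
  kellyDecomposition = record
    { T = tree ; W = ⁅_⁆ ; X = parentSet
    ; partition = singletons-Partition bidirectedTree
    ; guarding  = λ i → W≥-disjoint i , λ u v → W≥-closed i
    ; children  = childrenCond
    ; roots     = rootsCond
    }

  kellyDecomposition-width : ∀ i → ∣ ⁅ i ⁆ ∪ parentSet i ∣ ≤ 2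
  kellyDecomposition-width i = ∣p∣≤length (⁅ i ⁆ ∪ parentSet i) (toℕ i ∷ parent H 0 (toℕ i) ∷ []) ⊆i,pi
    where
    ⊆i,pi : ∀ x → x ∈ ⁅ i ⁆ ∪ parentSet i → toℕ x ∈ˡ toℕ i ∷ parent H 0 (toℕ i) ∷ []
    ⊆i,pi x x∈ with x∈p∪q⁻ ⁅ i ⁆ (parentSet i) x∈
    ... | inj₁ x∈i = here (cong toℕ (x∈⁅y⁆⇒x≡y i x∈i))
    ... | inj₂ x∈X = there (here (sym (proj₂ (∈-decSubset⁻ (_isParentOf? i) x∈X))))

  OpenAt : Vertex → Vertex → Set
  OpenAt i u = toℕ u < toℕ i × ∃ λ v → toℕ i ≤ toℕ v × u IsParentOf v

  openAt? : ∀ i u → Dec (OpenAt i u)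
  openAt? i u = (toℕ u <? toℕ i) ×-dec any? (λ v → (toℕ i ≤? toℕ v) ×-dec (u isParentOf? v))

  openSet : Vertex → Subset (size H)
  openSet i = decSubset (openAt? i)

  Later : Vertex → Vertex → Set
  Later i v = ∃ λ j → toℕ i ≤ toℕ j × v ∈ ⁅ j ⁆

  Later-closed : ∀ i {u v} → Later i u → arc bidirectedTree u v ≡ true → Later i v ⊎ v ∈ openSet i
  Later-closed i {u} {v} (j , i≤j , u∈j) uv with x∈⁅y⁆⇒x≡y j u∈j | toℕ i ≤? toℕ v
  ... | refl | yes i≤v = inj₁ (v , i≤v , x∈⁅x⁆ v)
  ... | refl | no  i≰v with Edge-of-arc uv
  ...   | inj₁ u→v = contradiction (≤-trans i≤j (<⇒≤ (IsParentOf⇒< u→v))) i≰v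
  ...   | inj₂ v→u = inj₂ (∈-decSubset⁺ (openAt? i) (≰⇒> i≰v , u , i≤j , v→u))

  Later-disjoint : ∀ i v → Later i v → v ∈ openSet i → ⊥
  Later-disjoint i v (j , i≤j , v∈j) v∈X with x∈⁅y⁆⇒x≡y j v∈j
  ... | refl = <⇒≱ (proj₁ (∈-decSubset⁻ (openAt? i) v∈X)) i≤j

  openSet-step : ∀ i j → toℕ j ≡ suc (toℕ i) → ∀ v → v ∈ openSet j → v ∈ ⁅ i ⁆ ⊎ v ∈ openSet i
  openSet-step i j j≡1+i v v∈X with ∈-decSubset⁻ (openAt? j) v∈X | toℕ v ≟ toℕ i
  ... | _ | yes v≡i = inj₁ (subst (λ i → v ∈ ⁅ i ⁆) (toℕ-injective v≡i) (x∈⁅x⁆ v))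
  ... | v<j , w , j≤w , v→w | no v≢i =
    inj₂ (∈-decSubset⁺ (openAt? i) (≤∧≢⇒< (≤-pred (subst (toℕ v <_) j≡1+i v<j)) v≢i , w ,
                                    ≤-trans (n≤1+n (toℕ i)) (subst (_≤ toℕ w) j≡1+i j≤w) , v→w))

  kellyPathDecomposition : KellyPathDecomposition bidirectedTree
  kellyPathDecomposition = record
    { l         = size H
    ; W         = ⁅_⁆
    ; X         = openSet
    ; partition = singletons-Partition bidirectedTree
    ; guarding  = λ i → Later-disjoint i , λ u v → Later-closed i
    ; pathCond  = openSet-step
    }

  kellyPathDecomposition-width : ∀ i → ∣ ⁅ i ⁆ ∪ openSet i ∣ ≤ suc H
  kellyPathDecomposition-width i =
    ≤-trans (∣p∣≤length (⁅ i ⁆ ∪ openSet i) (toℕ i ∷ ancestors H 0 (toℕ i)) ⊆i,ancestors)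
            (s≤s (length-ancestors H 0 (toℕ i)))
    where
    ⊆i,ancestors : ∀ x → x ∈ ⁅ i ⁆ ∪ openSet i → toℕ x ∈ˡ toℕ i ∷ ancestors H 0 (toℕ i)
    ⊆i,ancestors x x∈ with x∈p∪q⁻ ⁅ i ⁆ (openSet i) x∈
    ... | inj₁ x∈i = here (cong toℕ (x∈⁅y⁆⇒x≡y i x∈i))
    ... | inj₂ x∈X with ∈-decSubset⁻ (openAt? i) x∈X
    ...   | x<i , v , i≤v , (_ , pv≡x) = there (∈-ancestors H 0 z≤n x<i i≤v (toℕ<n v) pv≡x)

-- Lower bound for Kelly pathwidth

module PathwidthLowerBound (H : ℕ) (D : KellyPathDecomposition (TernaryTree.bidirectedTree H)) where
  open TernaryTree H
  open KellyPathDecomposition D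
  open KellyPathDecompositionProperties D

  record Crowded (h a : ℕ) : Set where
    field
      t            : Fin l
      crowd        : List Vertex
      crowd-unique : Unique crowd
      length-crowd : length crowd ≡ suc h
      crowd⊆       : All (λ x → InSubtreeᵛ h a x × x ∈ W t ∪ X t) crowd
      early        : Vertex
      early∈       : InSubtreeᵛ h a early
      early≤t      : toℕ (bag early) ≤ toℕ t
      late         : Vertex
      late∈        : InSubtreeᵛ h a late
      t≤late       : toℕ t ≤ toℕ (bag late)

  crowded-leaf : ∀ {a} → Position 0 a → Crowded 0 a
  crowded-leaf p = record
    { t = bag r ; crowd = r ∷ [] ; crowd-unique = [] ∷ [] ; length-crowd = refl
    ; crowd⊆ = (rootVertex∈ p , x∈p∪q⁺ (inj₁ (∈-bag r))) ∷ []
    ; early = r ; early∈ = rootVertex∈ p ; early≤t = ≤-refl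
    ; late  = r ; late∈  = rootVertex∈ p ; t≤late  = ≤-refl
    }
    where r = rootVertex p

  crowded-step : ∀ {h a} → Position (suc h) a → ∀ {A B C} → A ≢ B → C ≢ B →
                 (cA : Crowded h (childRoot h a A)) (cB : Crowded h (childRoot h a B))
                 (cC : Crowded h (childRoot h a C)) →
                 toℕ (Crowded.t cA) ≤ toℕ (Crowded.t cB) → toℕ (Crowded.t cB) ≤ toℕ (Crowded.t cC) →
                 Crowded (suc h) a
  crowded-step {h} {a} p {A} {B} A≢B C≢B cA cB cC tA≤tB tB≤tC = record
    { t            = t
    ; crowd        = w ∷ crowd
    ; crowd-unique = All.map (λ x∈ w≡x → proj₂ w-outside (subst (InSubtreeᵛ h _) (sym w≡x) (proj₁ x∈))) crowd⊆
                     ∷ crowd-unique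
    ; length-crowd = cong suc length-crowd
    ; crowd⊆       = (proj₁ w-outside , w∈W∪X) ∷ All.map (λ (x∈ , x∈W∪X) → lift x∈ , x∈W∪X) crowd⊆
    ; early = early ; early∈ = lift early∈ ; early≤t = early≤t
    ; late  = late  ; late∈  = lift late∈  ; t≤late  = t≤late
    }
    where
    open Crowded cB
    lift = InChild⇒InSubtree h a B
    walk = walk-between-siblings p A≢B C≢B (Crowded.early∈ cA) (Crowded.late∈ cC)
    meeting = walk-meets-W∪X (OutsideChild-of-sibling A≢B (Crowded.early∈ cA))
                (mapStar EdgeWithin⇒BackArc walk)
                (≤-trans (Crowded.early≤t cA) tA≤tB) (≤-trans tB≤tC (Crowded.t≤late cC))
    w = proj₁ meeting
    w-outside = proj₁ (proj₂ meeting)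
    w∈W∪X = proj₂ (proj₂ meeting)

  crowded : ∀ h {a} → Position h a → Crowded h a
  crowded zero    p = crowded-leaf p
  crowded (suc h) p with median-branch (λ k → toℕ (Crowded.t (crowded h (child k p))))
  ... | A , B , C , A≢B , C≢B , tA≤tB , tB≤tC =
    crowded-step p A≢B C≢B (crowded h (child A p)) (crowded h (child B p)) (crowded h (child C p))
                 tA≤tB tB≤tC

  width≥ : ∀ {w} → (∀ i → ∣ W i ∪ X i ∣ ≤ w) → suc H ≤ w
  width≥ {w} width≤ = begin
    suc H      ≡⟨ length-crowd ⟨
    length crowd ≤⟨ Unique⇒length≤∣p∣ (W t ∪ X t) crowd-unique (All.map proj₂ crowd⊆) ⟩
    ∣ W t ∪ X t ∣ ≤⟨ width≤ t ⟩
    w ∎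
    where
    open ≤-Reasoning
    open Crowded (crowded H whole)

module _ (H : ℕ) where
  open TernaryTree H

  kpw-bidirectedTree : KellyPathwidth bidirectedTree (suc H)
  kpw-bidirectedTree = (kellyPathDecomposition , kellyPathDecomposition-width) ,
                       λ w (D , width≤) → PathwidthLowerBound.width≥ H D width≤

module _ (h : ℕ) where
  open TernaryTree (suc h)

  kw-bidirectedTree : KellyWidth bidirectedTree 2
  kw-bidirectedTree = (kellyDecomposition , kellyDecomposition-width) ,
                      λ w (D , width≤) →
                        width≥2-of-2-cycle D r≢c (arc-of-Edge (inj₁ r→c)) (arc-of-Edge (inj₂ r→c)) width≤
    where
    r→c = rootVertex-IsParentOf left whole
    r≢c = λ r≡c → <-irrefl (cong toℕ r≡c) (IsParentOf⇒< r→c)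

mainTheorem7 : (k : ℕ) → Σ Digraph λ G → Σ ℕ λ p →
    KellyPathwidth G p × k ≤ p × KellyWidth G 2
mainTheorem7 k = TernaryTree.bidirectedTree (suc k) , suc (suc k) ,
  kpw-bidirectedTree (suc k) , ≤-trans (n≤1+n k) (n≤1+n (suc k)) , kw-bidirectedTree k
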